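{- Let $m\ge1$ be an integer and define numbers $\binom{n}{k}_m$ for integers $0\le k\le n$ by $\binom{n}{0}_m=1$ for all $n\ge0$, $\binom{n}{n}_m=\delta_{n\bmod m,0}$ for all $n\ge0$ (so $1$ if $m$ divides $n$ and $0$ otherwise), and $\binom{n}{k}_m=\binom{n-1}{k}_m+\binom{n-1}{k-1}_m$ for $0<k<n$. Then the lower triangular array with entries $\binom{n}{k}_m$ is the row-reversed $(1/(1-x^m),\,x/(1-x))$ Riordan array; that is, for all $0\le k\le n$, \[ \binom{n}{k}_m=\left(\frac{1}{1-x^m},\frac{x}{1-x}\right)_{n,n-k}. \]
   Context: For formal power series $p(x)=p_0+p_1x+p_2x^2+\cdots$ and $q(x)=q_1x+q_2x^2+\cdots$, the $(p(x),q(x))$ Riordan array is the infinite lower triangular matrix with $(n,k)$-th entry ($n,k\ge0$) $(p(x),q(x))_{n,k}=[x^n]\,p(x)(q(x))^k$, where $[x^n]$ extracts the coefficient of $x^n$. The row-reversed $(p,q)$ Riordan array is the lower triangular matrix whose $(n,k)$-th entry, for $0\le k\le n$, is $(p(x),q(x))_{n,n-k}$ (each row reversed up to and including the main diagonal). $\delta_{i,j}$ is $1$ if $i=j$ and $0$ otherwise. -}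

module Defs where

open import Data.Nat as ℕ using (ℕ; zero; suc; _∸_; _<_; _≟_; _<?_)
open import Data.Nat.Divisibility using (_∣?_)
open import Data.Integer using (ℤ; 0ℤ; 1ℤ; _+_; _*_; _-_)
open import Relation.Nullary using (yes; no)

FPS : Set
FPS = ℕ → ℤ

sumTo : ℕ → (ℕ → ℤ) → ℤ
sumTo zero    f = f 0
sumTo (suc n) f = sumTo n f + f (suc n)

_⋆_ : FPS → FPS → FPS
(f ⋆ g) n = sumTo n (λ i → f i * g (n ∸ i))

_⊝_ : FPS → FPS → FPS
(f ⊝ g) n = f n - g n

X^ : ℕ → FPS
X^ j n with n ≟ j
... | yes _ = 1ℤ
... | no  _ = 0ℤ

oneS : FPS
oneS = X^ 0

_^S_ : FPS → ℕ → FPS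
f ^S zero  = oneS
f ^S suc k = f ⋆ (f ^S k)

riordan : FPS → FPS → ℕ → ℕ → ℤ
riordan p q n k = (p ⋆ (q ^S k)) n

δdiv : ℕ → ℕ → ℕ
δdiv m n with m ∣? n
... | yes _ = 1
... | no  _ = 0

-- the numbers binom(n,k)_m for 0 ≤ k ≤ n (value 0 for k > n, irrelevant)
mbinom : ℕ → ℕ → ℕ → ℕ
mbinom m n       zero    = 1
mbinom m zero    (suc k) = 0
mbinom m (suc n) (suc k) with suc k ≟ suc n | suc k <? suc n
... | yes _ | _     = δdiv m (suc n)
... | no  _ | yes _ = mbinom m n (suc k) ℕ.+ mbinom m n k
... | no  _ | no  _ = 0

{-# OPTIONS --safe #-}
-- Both generating functions are pinned down by their defining equations:
-- p (1 - x^m) = 1 forces p n = p (n - m), so p is the indicator of multiples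
-- of m, and q (1 - x) = x forces q = x + x² + ⋯.  Multiplying a series by
-- x/(1 - x) takes partial sums, so the columns of (p, q) obey Pascal's rule
-- R (n+1) (j+1) = R n (j+1) + R n j, with R n n = p 0 = 1 and R n 0 = p n.
-- After reversing the rows these are exactly the three clauses defining
-- binom(n,k)_m, and induction on n finishes the argument.
module Submission where

open import Defs
open import Data.Nat as ℕ using (ℕ; zero; suc; _≤_; _<_; _∸_; _≟_; _<?_; z≤n; s≤s)
import Data.Nat.Properties as ℕ
open import Data.Nat.Induction using (<-rec)
open import Data.Nat.Divisibility using (_∣_; _∣?_; _∣0; ∣-refl; ∣⇒≤; ∣m∣n⇒∣m+n; ∣m+n∣m⇒∣n)
open import Data.Integer using (ℤ; +_; 0ℤ; 1ℤ; _+_; _*_; _-_)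
import Data.Integer.Properties as ℤ
open import Data.Integer.Tactic.RingSolver using (solve-∀)
open import Data.Empty using (⊥-elim)
open import Data.Sum using (inj₁; inj₂)
open import Function using (_∘_)
open import Relation.Nullary using (¬_; Dec; yes; no)
open import Relation.Binary.PropositionalEquality
open ≡-Reasoning

sumTo-cong : ∀ n {f g : ℕ → ℤ} → (∀ i → i ≤ n → f i ≡ g i) → sumTo n f ≡ sumTo n g
sumTo-cong zero    f≗g = f≗g 0 z≤n
sumTo-cong (suc n) f≗g =
  cong₂ _+_ (sumTo-cong n (λ i i≤n → f≗g i (ℕ.m≤n⇒m≤1+n i≤n))) (f≗g (suc n) ℕ.≤-refl)

sumTo-zero : ∀ n {f : ℕ → ℤ} → (∀ i → i ≤ n → f i ≡ 0ℤ) → sumTo n f ≡ 0ℤ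
sumTo-zero zero    f≗0 = f≗0 0 z≤n
sumTo-zero (suc n) f≗0 =
  cong₂ _+_ (sumTo-zero n (λ i i≤n → f≗0 i (ℕ.m≤n⇒m≤1+n i≤n))) (f≗0 (suc n) ℕ.≤-refl)

sumTo-distrib-+ : ∀ n (f g : ℕ → ℤ) → sumTo n (λ i → f i + g i) ≡ sumTo n f + sumTo n g
sumTo-distrib-+ zero    f g = refl
sumTo-distrib-+ (suc n) f g rewrite sumTo-distrib-+ n f g =
  interchange (sumTo n f) (sumTo n g) (f (suc n)) (g (suc n))
  where
  interchange : ∀ a b c d → (a + b) + (c + d) ≡ (a + c) + (b + d)
  interchange = solve-∀

sumTo-distrib-- : ∀ n (f g : ℕ → ℤ) → sumTo n (λ i → f i - g i) ≡ sumTo n f - sumTo n g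
sumTo-distrib-- zero    f g = refl
sumTo-distrib-- (suc n) f g rewrite sumTo-distrib-- n f g =
  interchange (sumTo n f) (sumTo n g) (f (suc n)) (g (suc n))
  where
  interchange : ∀ a b c d → (a - b) + (c - d) ≡ (a + c) - (b + d)
  interchange = solve-∀

sumTo-suc : ∀ n (f : ℕ → ℤ) → sumTo (suc n) f ≡ f 0 + sumTo n (f ∘ suc)
sumTo-suc zero    f = refl
sumTo-suc (suc n) f rewrite sumTo-suc n f = ℤ.+-assoc (f 0) _ _

X^-diag : ∀ j → X^ j j ≡ 1ℤ
X^-diag j with j ≟ j
... | yes _   = refl
... | no  j≢j = ⊥-elim (j≢j refl)

X^-off : ∀ j n → n ≢ j → X^ j n ≡ 0ℤ
X^-off j n n≢j with n ≟ j
... | yes n≡j = ⊥-elim (n≢j n≡j)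
... | no  _   = refl

X^-suc-zero : ∀ j → X^ (suc j) 0 ≡ 0ℤ
X^-suc-zero j = X^-off (suc j) 0 λ ()

X^-suc : ∀ j k → X^ (suc j) (suc k) ≡ X^ j k
X^-suc j k = by-cases (k ≟ j)
  where
  by-cases : Dec (k ≡ j) → X^ (suc j) (suc k) ≡ X^ j k
  by-cases (yes refl) = trans (X^-diag (suc k)) (sym (X^-diag k))
  by-cases (no  k≢j)  = trans (X^-off (suc j) (suc k) (k≢j ∘ ℕ.suc-injective)) (sym (X^-off j k k≢j))

⋆-congˡ : ∀ (f : FPS) {g h : FPS} → (∀ t → g t ≡ h t) → ∀ n → (f ⋆ g) n ≡ (f ⋆ h) n
⋆-congˡ f g≗h n = sumTo-cong n (λ i _ → cong (f i *_) (g≗h (n ∸ i)))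

⋆-distribˡ-+ : ∀ (f g h : FPS) n → (f ⋆ (λ t → g t + h t)) n ≡ (f ⋆ g) n + (f ⋆ h) n
⋆-distribˡ-+ f g h n =
  trans (sumTo-cong n (λ i _ → ℤ.*-distribˡ-+ (f i) (g (n ∸ i)) (h (n ∸ i))))
        (sumTo-distrib-+ n _ _)

⋆-distribˡ-⊝ : ∀ (f g h : FPS) n → (f ⋆ (g ⊝ h)) n ≡ (f ⋆ g) n - (f ⋆ h) n
⋆-distribˡ-⊝ f g h n =
  trans (sumTo-cong n (λ i _ → distrib (f i) (g (n ∸ i)) (h (n ∸ i))))
        (sumTo-distrib-- n _ _)
  where
  distrib : ∀ a b c → a * (b - c) ≡ a * b - a * c
  distrib = solve-∀

⋆-shift : ∀ (f g : FPS) → g 0 ≡ 0ℤ → ∀ n → (f ⋆ g) (suc n) ≡ (f ⋆ (g ∘ suc)) n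
⋆-shift f g g0≡0 n = begin
  sumTo n (λ i → f i * g (suc n ∸ i)) + f (suc n) * g (n ∸ n)
    ≡⟨ cong₂ _+_ (sumTo-cong n (λ i i≤n → cong (λ t → f i * g t) (ℕ.+-∸-assoc 1 i≤n)))
                 (trans (cong (λ t → f (suc n) * g t) (ℕ.n∸n≡0 n))
                        (trans (cong (f (suc n) *_) g0≡0) (ℤ.*-zeroʳ (f (suc n))))) ⟩
  (f ⋆ (g ∘ suc)) n + 0ℤ
    ≡⟨ ℤ.+-identityʳ _ ⟩
  (f ⋆ (g ∘ suc)) n ∎

⋆-identityʳ : ∀ (f : FPS) n → (f ⋆ oneS) n ≡ f n
⋆-identityʳ f zero    = ℤ.*-identityʳ (f 0)
⋆-identityʳ f (suc n) = begin
  sumTo n (λ i → f i * oneS (suc n ∸ i)) + f (suc n) * oneS (n ∸ n)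
    ≡⟨ cong₂ _+_ (sumTo-zero n off-diagonal)
                 (trans (cong (λ t → f (suc n) * oneS t) (ℕ.n∸n≡0 n))
                        (ℤ.*-identityʳ (f (suc n)))) ⟩
  0ℤ + f (suc n)
    ≡⟨ ℤ.+-identityˡ _ ⟩
  f (suc n) ∎
  where
  off-diagonal : ∀ i → i ≤ n → f i * oneS (suc n ∸ i) ≡ 0ℤ
  off-diagonal i i≤n = begin
    f i * oneS (suc n ∸ i)   ≡⟨ cong (λ t → f i * oneS t) (ℕ.+-∸-assoc 1 i≤n) ⟩
    f i * oneS (suc (n ∸ i)) ≡⟨ cong (f i *_) (X^-off 0 (suc (n ∸ i)) λ ()) ⟩
    f i * 0ℤ                 ≡⟨ ℤ.*-zeroʳ (f i) ⟩
    0ℤ                       ∎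

⋆-X^-+ : ∀ (f : FPS) j n → (f ⋆ X^ j) (j ℕ.+ n) ≡ f n
⋆-X^-+ f zero    n = ⋆-identityʳ f n
⋆-X^-+ f (suc j) n = begin
  (f ⋆ X^ (suc j)) (suc j ℕ.+ n)     ≡⟨ ⋆-shift f (X^ (suc j)) (X^-suc-zero j) (j ℕ.+ n) ⟩
  (f ⋆ (X^ (suc j) ∘ suc)) (j ℕ.+ n) ≡⟨ ⋆-congˡ f (X^-suc j) (j ℕ.+ n) ⟩
  (f ⋆ X^ j) (j ℕ.+ n)               ≡⟨ ⋆-X^-+ f j n ⟩
  f n                                ∎

⋆-X^-< : ∀ (f : FPS) j n → n < j → (f ⋆ X^ j) n ≡ 0ℤ
⋆-X^-< f (suc j) zero    _         = trans (cong (f 0 *_) (X^-suc-zero j)) (ℤ.*-zeroʳ (f 0))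
⋆-X^-< f (suc j) (suc n) (s≤s n<j) = begin
  (f ⋆ X^ (suc j)) (suc n)  ≡⟨ ⋆-shift f (X^ (suc j)) (X^-suc-zero j) n ⟩
  (f ⋆ (X^ (suc j) ∘ suc)) n ≡⟨ ⋆-congˡ f (X^-suc j) n ⟩
  (f ⋆ X^ j) n               ≡⟨ ⋆-X^-< f j n n<j ⟩
  0ℤ                         ∎

⋆-one-⊝-X^-solve : ∀ (f r : FPS) j → (∀ n → (f ⋆ (oneS ⊝ X^ j)) n ≡ r n) →
                   ∀ n → f n ≡ r n + (f ⋆ X^ j) n
⋆-one-⊝-X^-solve f r j f⋆[1-xʲ]≗r n = begin
  f n                         ≡⟨ sym (minus-plus (f n) (g n)) ⟩
  (f n - g n) + g n           ≡⟨ cong (λ t → (t - g n) + g n) (sym (⋆-identityʳ f n)) ⟩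
  ((f ⋆ oneS) n - g n) + g n  ≡⟨ cong (_+ g n) (sym (⋆-distribˡ-⊝ f oneS (X^ j) n)) ⟩
  (f ⋆ (oneS ⊝ X^ j)) n + g n ≡⟨ cong (_+ g n) (f⋆[1-xʲ]≗r n) ⟩
  r n + g n                   ∎
  where
  g : FPS
  g = f ⋆ X^ j
  minus-plus : ∀ a b → (a - b) + b ≡ a
  minus-plus = solve-∀

periodic-ext : ∀ {A : Set} m → 1 ≤ m → {f g : ℕ → A} →
               (∀ n → f (m ℕ.+ n) ≡ f n) → (∀ n → g (m ℕ.+ n) ≡ g n) →
               (∀ n → n < m → f n ≡ g n) → ∀ n → f n ≡ g n
periodic-ext m 1≤m {f} {g} f-periodic g-periodic f≗g-below = <-rec _ step
  where
  step : ∀ n → (∀ {n′} → n′ < n → f n′ ≡ g n′) → f n ≡ g n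
  step n ih with n <? m
  ... | yes n<m = f≗g-below n n<m
  ... | no  n≮m = begin
    f n               ≡⟨ cong f (sym m+[n∸m]≡n) ⟩
    f (m ℕ.+ (n ∸ m)) ≡⟨ f-periodic (n ∸ m) ⟩
    f (n ∸ m)         ≡⟨ ih (ℕ.∸-monoʳ-< 1≤m (ℕ.≮⇒≥ n≮m)) ⟩
    g (n ∸ m)         ≡⟨ sym (g-periodic (n ∸ m)) ⟩
    g (m ℕ.+ (n ∸ m)) ≡⟨ cong g m+[n∸m]≡n ⟩
    g n               ∎
    where
    m+[n∸m]≡n : m ℕ.+ (n ∸ m) ≡ n
    m+[n∸m]≡n = ℕ.m+[n∸m]≡n (ℕ.≮⇒≥ n≮m)

δdiv-yes : ∀ {m n} → m ∣ n → δdiv m n ≡ 1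
δdiv-yes {m} {n} m∣n with m ∣? n
... | yes _   = refl
... | no  m∤n = ⊥-elim (m∤n m∣n)

δdiv-no : ∀ {m n} → ¬ m ∣ n → δdiv m n ≡ 0
δdiv-no {m} {n} m∤n with m ∣? n
... | yes m∣n = ⊥-elim (m∤n m∣n)
... | no  _   = refl

δdiv-periodic : ∀ m n → δdiv m (m ℕ.+ n) ≡ δdiv m n
δdiv-periodic m n with m ∣? n
... | yes m∣n = δdiv-yes (∣m∣n⇒∣m+n ∣-refl m∣n)
... | no  m∤n = δdiv-no (λ m∣m+n → m∤n (∣m+n∣m⇒∣n m∣m+n ∣-refl))

δdiv-below : ∀ {m n} → n < m → + δdiv m n ≡ oneS n
δdiv-below {m} {zero}  _     = trans (cong +_ (δdiv-yes (m ∣0))) (sym (X^-diag 0))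
δdiv-below {m} {suc n} 1+n<m =
  trans (cong +_ (δdiv-no (ℕ.<⇒≱ 1+n<m ∘ ∣⇒≤))) (sym (X^-off 0 (suc n) λ ()))

one-⊝-X^-inverse : ∀ m → 1 ≤ m → (p : FPS) →
                   (∀ n → (p ⋆ (oneS ⊝ X^ m)) n ≡ oneS n) →
                   ∀ n → p n ≡ + δdiv m n
one-⊝-X^-inverse m 1≤m p p[1-xᵐ]≗1 =
  periodic-ext m 1≤m p-periodic (cong +_ ∘ δdiv-periodic m) p≗δdiv-below
  where
  p≗1+p⋆xᵐ : ∀ n → p n ≡ oneS n + (p ⋆ X^ m) n
  p≗1+p⋆xᵐ = ⋆-one-⊝-X^-solve p oneS m p[1-xᵐ]≗1

  p-periodic : ∀ n → p (m ℕ.+ n) ≡ p n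
  p-periodic n = begin
    p (m ℕ.+ n)                               ≡⟨ p≗1+p⋆xᵐ (m ℕ.+ n) ⟩
    oneS (m ℕ.+ n) + (p ⋆ X^ m) (m ℕ.+ n)     ≡⟨ cong₂ _+_ (X^-off 0 (m ℕ.+ n) m+n≢0) (⋆-X^-+ p m n) ⟩
    0ℤ + p n                                  ≡⟨ ℤ.+-identityˡ (p n) ⟩
    p n                                       ∎
    where
    m+n≢0 : m ℕ.+ n ≢ 0
    m+n≢0 m+n≡0 = ℕ.<⇒≱ 1≤m (subst (m ≤_) m+n≡0 (ℕ.m≤m+n m n))

  p≗δdiv-below : ∀ n → n < m → p n ≡ + δdiv m n
  p≗δdiv-below n n<m = begin
    p n                         ≡⟨ p≗1+p⋆xᵐ n ⟩
    oneS n + (p ⋆ X^ m) n       ≡⟨ cong (λ t → oneS n + t) (⋆-X^-< p m n n<m) ⟩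
    oneS n + 0ℤ                 ≡⟨ ℤ.+-identityʳ (oneS n) ⟩
    oneS n                      ≡⟨ sym (δdiv-below n<m) ⟩
    + δdiv m n                  ∎

module _ (q : FPS) (q[1-x]≗x : ∀ n → (q ⋆ (oneS ⊝ X^ 1)) n ≡ X^ 1 n) where

  private
    q≗x+q⋆x : ∀ n → q n ≡ X^ 1 n + (q ⋆ X^ 1) n
    q≗x+q⋆x = ⋆-one-⊝-X^-solve q (X^ 1) 1 q[1-x]≗x

  x/[1-x]-zero : q 0 ≡ 0ℤ
  x/[1-x]-zero = begin
    q 0                       ≡⟨ q≗x+q⋆x 0 ⟩
    X^ 1 0 + (q ⋆ X^ 1) 0     ≡⟨ cong₂ _+_ (X^-suc-zero 0) (⋆-X^-< q 1 0 (s≤s z≤n)) ⟩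
    0ℤ                        ∎

  x/[1-x]-suc : ∀ k → q (suc k) ≡ 1ℤ
  x/[1-x]-suc zero = begin
    q 1                       ≡⟨ q≗x+q⋆x 1 ⟩
    X^ 1 1 + (q ⋆ X^ 1) 1     ≡⟨ cong₂ _+_ (X^-diag 1) (⋆-X^-+ q 1 0) ⟩
    1ℤ + q 0                  ≡⟨ trans (cong (λ t → 1ℤ + t) x/[1-x]-zero) (ℤ.+-identityʳ 1ℤ) ⟩
    1ℤ                        ∎
  x/[1-x]-suc (suc k) = begin
    q (2 ℕ.+ k)                       ≡⟨ q≗x+q⋆x (2 ℕ.+ k) ⟩
    X^ 1 (2 ℕ.+ k) + (q ⋆ X^ 1) (2 ℕ.+ k) ≡⟨ cong₂ _+_ (X^-off 1 (2 ℕ.+ k) λ ()) (⋆-X^-+ q 1 (suc k)) ⟩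
    0ℤ + q (suc k)                    ≡⟨ ℤ.+-identityˡ _ ⟩
    q (suc k)                         ≡⟨ x/[1-x]-suc k ⟩
    1ℤ                                ∎

module PartialSums (q : FPS) (q-zero : q 0 ≡ 0ℤ) (q-suc : ∀ k → q (suc k) ≡ 1ℤ) where

  ⋆-suc-partial-sum : ∀ g n → (q ⋆ g) (suc n) ≡ sumTo n (λ i → g (n ∸ i))
  ⋆-suc-partial-sum g n = begin
    (q ⋆ g) (suc n)                                        ≡⟨ sumTo-suc n (λ i → q i * g (suc n ∸ i)) ⟩
    q 0 * g (suc n) + sumTo n (λ i → q (suc i) * g (n ∸ i)) ≡⟨ cong₂ _+_ (cong (_* g (suc n)) q-zero)
                                                                        (sumTo-cong n λ i _ → trans (cong (_* g (n ∸ i)) (q-suc i)) (ℤ.*-identityˡ _)) ⟩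
    0ℤ + sumTo n (λ i → g (n ∸ i))                         ≡⟨ ℤ.+-identityˡ _ ⟩
    sumTo n (λ i → g (n ∸ i))                              ∎

  ⋆-suc : ∀ g n → (q ⋆ g) (suc n) ≡ (q ⋆ g) n + g n
  ⋆-suc g zero = begin
    (q ⋆ g) 1        ≡⟨ ⋆-suc-partial-sum g 0 ⟩
    g 0              ≡⟨ sym (ℤ.+-identityˡ (g 0)) ⟩
    0ℤ + g 0         ≡⟨ cong (_+ g 0) (sym (cong (_* g 0) q-zero)) ⟩
    q 0 * g 0 + g 0  ∎
  ⋆-suc g (suc n) = begin
    (q ⋆ g) (2 ℕ.+ n)                           ≡⟨ ⋆-suc-partial-sum g (suc n) ⟩
    sumTo (suc n) (λ i → g (suc n ∸ i))         ≡⟨ sumTo-suc n (λ i → g (suc n ∸ i)) ⟩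
    g (suc n) + sumTo n (λ i → g (n ∸ i))       ≡⟨ ℤ.+-comm (g (suc n)) _ ⟩
    sumTo n (λ i → g (n ∸ i)) + g (suc n)       ≡⟨ cong (_+ g (suc n)) (sym (⋆-suc-partial-sum g n)) ⟩
    (q ⋆ g) (suc n) + g (suc n)                 ∎

  q^S-suc-zero : ∀ j → (q ^S suc j) 0 ≡ 0ℤ
  q^S-suc-zero j = cong (_* (q ^S j) 0) q-zero

  riordan-pascal : ∀ p n j → riordan p q (suc n) (suc j) ≡ riordan p q n (suc j) + riordan p q n j
  riordan-pascal p n j = begin
    (p ⋆ (q ^S suc j)) (suc n)                            ≡⟨ ⋆-shift p (q ^S suc j) (q^S-suc-zero j) n ⟩
    (p ⋆ ((q ^S suc j) ∘ suc)) n                          ≡⟨ ⋆-congˡ p (⋆-suc (q ^S j)) n ⟩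
    (p ⋆ (λ t → (q ^S suc j) t + (q ^S j) t)) n           ≡⟨ ⋆-distribˡ-+ p (q ^S suc j) (q ^S j) n ⟩
    (p ⋆ (q ^S suc j)) n + (p ⋆ (q ^S j)) n               ∎

  riordan-< : ∀ p n j → n < j → riordan p q n j ≡ 0ℤ
  riordan-< p zero    (suc j) _         = trans (cong (p 0 *_) (q^S-suc-zero j)) (ℤ.*-zeroʳ (p 0))
  riordan-< p (suc n) (suc j) (s≤s n<j) = begin
    riordan p q (suc n) (suc j)                 ≡⟨ riordan-pascal p n j ⟩
    riordan p q n (suc j) + riordan p q n j     ≡⟨ cong₂ _+_ (riordan-< p n (suc j) (ℕ.m≤n⇒m≤1+n n<j)) (riordan-< p n j n<j) ⟩
    0ℤ                                          ∎

  riordan-diag : ∀ p n → riordan p q n n ≡ p 0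
  riordan-diag p zero    = ℤ.*-identityʳ (p 0)
  riordan-diag p (suc n) = begin
    riordan p q (suc n) (suc n)                 ≡⟨ riordan-pascal p n n ⟩
    riordan p q n (suc n) + riordan p q n n     ≡⟨ cong₂ _+_ (riordan-< p n (suc n) ℕ.≤-refl) (riordan-diag p n) ⟩
    0ℤ + p 0                                    ≡⟨ ℤ.+-identityˡ (p 0) ⟩
    p 0                                         ∎

mbinom-diag : ∀ m n → mbinom m (suc n) (suc n) ≡ δdiv m (suc n)
mbinom-diag m n with suc n ≟ suc n
... | yes _     = refl
... | no  n≢n   = ⊥-elim (n≢n refl)

mbinom-pascal : ∀ m {n k} → k < n → mbinom m (suc n) (suc k) ≡ mbinom m n (suc k) ℕ.+ mbinom m n k
mbinom-pascal m {n} {k} k<n with suc k ≟ suc n | suc k <? suc n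
... | yes k≡n | _       = ⊥-elim (ℕ.<⇒≢ k<n (ℕ.suc-injective k≡n))
... | no  _   | yes _   = refl
... | no  _   | no  k≮n = ⊥-elim (k≮n (s≤s k<n))

module _ (m : ℕ) (R : ℕ → ℕ → ℤ)
         (R-diag : ∀ n → R n n ≡ 1ℤ)
         (R-zero : ∀ n → R n 0 ≡ + δdiv m n)
         (R-pascal : ∀ n j → R (suc n) (suc j) ≡ R n (suc j) + R n j) where

  mbinom≡reversed-row : ∀ n k → k ≤ n → + mbinom m n k ≡ R n (n ∸ k)
  mbinom≡reversed-row n       zero    _         = sym (R-diag n)
  mbinom≡reversed-row (suc n) (suc k) (s≤s k≤n) with ℕ.m≤n⇒m<n∨m≡n k≤n
  ... | inj₂ refl = begin
    + mbinom m (suc k) (suc k)  ≡⟨ cong +_ (mbinom-diag m k) ⟩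
    + δdiv m (suc k)            ≡⟨ sym (R-zero (suc k)) ⟩
    R (suc k) 0                 ≡⟨ cong (R (suc k)) (sym (ℕ.n∸n≡0 k)) ⟩
    R (suc k) (k ∸ k)           ∎
  ... | inj₁ k<n  = begin
    + mbinom m (suc n) (suc k)                        ≡⟨ cong +_ (mbinom-pascal m k<n) ⟩
    + (mbinom m n (suc k) ℕ.+ mbinom m n k)           ≡⟨ ℤ.pos-+ (mbinom m n (suc k)) (mbinom m n k) ⟩
    + mbinom m n (suc k) + + mbinom m n k             ≡⟨ cong₂ _+_ (mbinom≡reversed-row n (suc k) k<n)
                                                                   (mbinom≡reversed-row n k k≤n) ⟩
    R n (n ∸ suc k) + R n (n ∸ k)                     ≡⟨ ℤ.+-comm (R n (n ∸ suc k)) _ ⟩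
    R n (n ∸ k) + R n (n ∸ suc k)                     ≡⟨ cong (λ t → R n t + R n (n ∸ suc k)) n∸k≡1+n∸[1+k] ⟩
    R n (suc (n ∸ suc k)) + R n (n ∸ suc k)           ≡⟨ sym (R-pascal n (n ∸ suc k)) ⟩
    R (suc n) (suc (n ∸ suc k))                       ≡⟨ cong (R (suc n)) (sym n∸k≡1+n∸[1+k]) ⟩
    R (suc n) (n ∸ k)                                 ∎
    where
    n∸k≡1+n∸[1+k] : n ∸ k ≡ suc (n ∸ suc k)
    n∸k≡1+n∸[1+k] = ℕ.+-∸-assoc 1 k<n

theorem1 : (m : ℕ) → 1 ≤ m →
           (p q : FPS) →
           -- p = 1/(1 - x^m)
           (∀ n → (p ⋆ (oneS ⊝ X^ m)) n ≡ oneS n) →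
           -- q = x/(1 - x)
           (∀ n → (q ⋆ (oneS ⊝ X^ 1)) n ≡ X^ 1 n) →
           ∀ n k → k ≤ n → + (mbinom m n k) ≡ riordan p q n (n ∸ k)
theorem1 m 1≤m p q p[1-xᵐ]≗1 q[1-x]≗x =
  mbinom≡reversed-row m (riordan p q) R-diag R-zero (riordan-pascal p)
  where
  open PartialSums q (x/[1-x]-zero q q[1-x]≗x) (x/[1-x]-suc q q[1-x]≗x)

  p≗δdiv : ∀ n → p n ≡ + δdiv m n
  p≗δdiv = one-⊝-X^-inverse m 1≤m p p[1-xᵐ]≗1

  R-diag : ∀ n → riordan p q n n ≡ 1ℤ
  R-diag n = trans (riordan-diag p n) (trans (p≗δdiv 0) (cong +_ (δdiv-yes (m ∣0))))

  R-zero : ∀ n → riordan p q n 0 ≡ + δdiv m n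
  R-zero n = trans (⋆-identityʳ p n) (p≗δdiv n)
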